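{- Let $b\ge1$ and let $n\ge0$ be an integer with $n\le b-1$. For any $(2b+1,b)$-coloring $\varphi$ of the path $P^{2n+1}$ (vertices $v_0,\ldots,v_{2n+1}$), there exist two distinct sets $X,Y\subseteq\{1,\ldots,2b+1\}$ with $|X|=b-n$ and $|Y|=n+1$ such that for every $Y'\subseteq Y$ with $|Y'|=n$ there exists a $(2b+1,b)$-coloring $\varphi'$ of $P^{2n+1}$ with $\varphi'(v_0)=\varphi(v_0)$, $\varphi'(v_{2n+1})=\varphi(v_{2n+1})$ and $\varphi'(v_1)=X\cup Y'$.
   Context: A $(2b+1,b)$-coloring of a graph assigns to each vertex a $b$-subset of $\{1,\ldots,2b+1\}$ so that adjacent vertices receive disjoint sets. $P^m$ is the path with vertices $v_0,\ldots,v_m$ and edges $v_iv_{i+1}$. -}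

module Defs where

open import Data.Nat using (ℕ; suc; _+_; _*_)
open import Data.Fin using (Fin; inject₁) renaming (suc to fsuc)
open import Data.Fin.Subset using (Subset; ∣_∣; _∩_; Empty)
open import Relation.Binary.PropositionalEquality using (_≡_)

-- Vertices of the path P^m are v_0,...,v_m, modelled as Fin (suc m);
-- edges are v_i v_{i+1} for i : Fin m, i.e. (inject₁ i , suc i).
-- Colours {1,...,2b+1} are modelled as Fin (2b+1).

record Coloring (b m : ℕ) : Set where
  field
    col      : Fin (suc m) → Subset (2 * b + 1)
    size     : ∀ v → ∣ col v ∣ ≡ b
    disjoint : ∀ (i : Fin m) → Empty (col (inject₁ i) ∩ col (fsuc i))
open Coloring public

-- A (2b+1,b)-colouring of P^m is a walk of length m in the Kneser graph K(2b+1,b). The neighbours of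
-- a b-set s are the sets ∁ (s ∪ ⁅ z ⁆) with z ∉ s, so two steps can exchange any x ∈ s for any y ∉ s.
-- Consecutive sets of a walk from A are disjoint and miss only one colour together, so their overlaps
-- with A add up to b or b - 1; hence the overlap is at least b - t after 2t steps and at most t after
-- 2t + 1 steps. The last set B thus has at least b - n colours outside A; take X among them and let Y
-- be the n + 1 colours outside A ∪ X. Every X ∪ Y' is a b-set disjoint from A with at most n colours
-- outside B, and n exchanges, i.e. 2n steps, lead from it to B.
module Submission where

open import Defs
open import Data.Nat using (ℕ; suc; zero; _+_; _*_; _∸_; _≤_; _<_; s≤s; s≤s⁻¹; z≤n)
open import Data.Nat.Properties
open import Data.Nat.Solver using (module +-*-Solver)
open import Data.Fin using (Fin; fromℕ; inject₁) renaming (zero to fz; suc to fs)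
open import Data.Fin.Subset
  using (Subset; ∣_∣; _∪_; _⊆_; _∈_; _∉_; _∩_; _-_; ∁; ⁅_⁆; Empty; Nonempty; inside; outside)
  renaming (⊥ to ∅)
open import Data.Fin.Subset.Properties
open import Data.Product using (Σ; _×_; ∃-syntax; _,_; proj₁; proj₂)
open import Data.Sum using (_⊎_; inj₁; inj₂)
open import Data.Vec using ([]; _∷_; here)
open import Function using (_∘_)
open import Relation.Binary.PropositionalEquality
  using (_≡_; _≢_; refl; sym; trans; cong; cong₂; subst; module ≡-Reasoning)
open import Relation.Nullary using (yes; no; contradiction)

∣p∪q∣≡∣p∣+∣q∣ : ∀ {n} (p q : Subset n) → Empty (p ∩ q) → ∣ p ∪ q ∣ ≡ ∣ p ∣ + ∣ q ∣
∣p∪q∣≡∣p∣+∣q∣ [] [] _ = refl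
∣p∪q∣≡∣p∣+∣q∣ (inside ∷ p) (inside ∷ q) p∩q=∅ = contradiction (fz , here) p∩q=∅
∣p∪q∣≡∣p∣+∣q∣ (inside ∷ p) (outside ∷ q) p∩q=∅ = cong suc (∣p∪q∣≡∣p∣+∣q∣ p q (drop-∷-Empty p∩q=∅))
∣p∪q∣≡∣p∣+∣q∣ (outside ∷ p) (inside ∷ q) p∩q=∅ =
  trans (cong suc (∣p∪q∣≡∣p∣+∣q∣ p q (drop-∷-Empty p∩q=∅))) (sym (+-suc ∣ p ∣ ∣ q ∣))
∣p∪q∣≡∣p∣+∣q∣ (outside ∷ p) (outside ∷ q) p∩q=∅ = ∣p∪q∣≡∣p∣+∣q∣ p q (drop-∷-Empty p∩q=∅)

∣p∪q∣≤∣p∣+∣q∣ : ∀ {n} (p q : Subset n) → ∣ p ∪ q ∣ ≤ ∣ p ∣ + ∣ q ∣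
∣p∪q∣≤∣p∣+∣q∣ [] [] = z≤n
∣p∪q∣≤∣p∣+∣q∣ (inside ∷ p) (inside ∷ q) = s≤s (≤-trans (∣p∪q∣≤∣p∣+∣q∣ p q) (+-monoʳ-≤ ∣ p ∣ (n≤1+n ∣ q ∣)))
∣p∪q∣≤∣p∣+∣q∣ (inside ∷ p) (outside ∷ q) = s≤s (∣p∪q∣≤∣p∣+∣q∣ p q)
∣p∪q∣≤∣p∣+∣q∣ (outside ∷ p) (inside ∷ q) =
  ≤-trans (s≤s (∣p∪q∣≤∣p∣+∣q∣ p q)) (≤-reflexive (sym (+-suc ∣ p ∣ ∣ q ∣)))
∣p∪q∣≤∣p∣+∣q∣ (outside ∷ p) (outside ∷ q) = ∣p∪q∣≤∣p∣+∣q∣ p q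

∣p∣≡∣p∩q∣+∣p∩∁q∣ : ∀ {n} (p q : Subset n) → ∣ p ∣ ≡ ∣ p ∩ q ∣ + ∣ p ∩ ∁ q ∣
∣p∣≡∣p∩q∣+∣p∩∁q∣ [] [] = refl
∣p∣≡∣p∩q∣+∣p∩∁q∣ (inside ∷ p) (inside ∷ q) = cong suc (∣p∣≡∣p∩q∣+∣p∩∁q∣ p q)
∣p∣≡∣p∩q∣+∣p∩∁q∣ (inside ∷ p) (outside ∷ q) =
  trans (cong suc (∣p∣≡∣p∩q∣+∣p∩∁q∣ p q)) (sym (+-suc _ _))
∣p∣≡∣p∩q∣+∣p∩∁q∣ (outside ∷ p) (_ ∷ q) = ∣p∣≡∣p∩q∣+∣p∩∁q∣ p q

∣p∣+k≡n⇒∣∁p∣≡k : ∀ {n k} (p : Subset n) → ∣ p ∣ + k ≡ n → ∣ ∁ p ∣ ≡ k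
∣p∣+k≡n⇒∣∁p∣≡k {k = k} p eq = begin
  ∣ ∁ p ∣               ≡⟨ ∣∁p∣≡n∸∣p∣ p ⟩
  _ ∸ ∣ p ∣             ≡⟨ cong (_∸ ∣ p ∣) (sym eq) ⟩
  ∣ p ∣ + k ∸ ∣ p ∣     ≡⟨ m+n∸m≡n ∣ p ∣ k ⟩
  k                     ∎
  where open ≡-Reasoning

∣p∩∁q∣≡∣q∩∁p∣ : ∀ {n} (p q : Subset n) → ∣ p ∣ ≡ ∣ q ∣ → ∣ p ∩ ∁ q ∣ ≡ ∣ q ∩ ∁ p ∣
∣p∩∁q∣≡∣q∩∁p∣ p q ∣p∣≡∣q∣ = +-cancelˡ-≡ ∣ p ∩ q ∣ _ _ (begin
  ∣ p ∩ q ∣ + ∣ p ∩ ∁ q ∣  ≡⟨ ∣p∣≡∣p∩q∣+∣p∩∁q∣ p q ⟨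
  ∣ p ∣                    ≡⟨ ∣p∣≡∣q∣ ⟩
  ∣ q ∣                    ≡⟨ ∣p∣≡∣p∩q∣+∣p∩∁q∣ q p ⟩
  ∣ q ∩ p ∣ + ∣ q ∩ ∁ p ∣  ≡⟨ cong (λ r → ∣ r ∣ + ∣ q ∩ ∁ p ∣) (∩-comm q p) ⟩
  ∣ p ∩ q ∣ + ∣ q ∩ ∁ p ∣  ∎)
  where open ≡-Reasoning

x∈p⇒0<∣p∣ : ∀ {n} {x : Fin n} {p : Subset n} → x ∈ p → 0 < ∣ p ∣
x∈p⇒0<∣p∣ x∈p = ≤-<-trans z≤n (x∈p⇒∣p-x∣<∣p∣ x∈p)

Empty⇒∣p∣≡0 : ∀ {n} {p : Subset n} → Empty p → ∣ p ∣ ≡ 0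
Empty⇒∣p∣≡0 {n} p=∅ = trans (cong ∣_∣ (Empty-unique p=∅)) (∣⊥∣≡0 n)

0<∣p∣⇒Nonempty : ∀ {n} (p : Subset n) → 0 < ∣ p ∣ → Nonempty p
0<∣p∣⇒Nonempty p 0<∣p∣ with nonempty? p
... | yes ne = ne
... | no p=∅ = contradiction (sym (Empty⇒∣p∣≡0 p=∅)) (<⇒≢ 0<∣p∣)

p⊆q∧∣p∣≡∣q∣⇒p≡q : ∀ {n} {p q : Subset n} → p ⊆ q → ∣ p ∣ ≡ ∣ q ∣ → p ≡ q
p⊆q∧∣p∣≡∣q∣⇒p≡q {p = p} {q} p⊆q ∣p∣≡∣q∣ = ⊆-antisym p⊆q q⊆p
  where
  q⊆p : q ⊆ p
  q⊆p {x} x∈q with x ∈? p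
  ... | yes x∈p = x∈p
  ... | no x∉p = contradiction ∣p∣≡∣q∣ (<⇒≢ (p⊂q⇒∣p∣<∣q∣ (p⊆q , x , x∈q , x∉p)))

subset-of-size : ∀ {n} k (p : Subset n) → k ≤ ∣ p ∣ → ∃[ q ] (q ⊆ p × ∣ q ∣ ≡ k)
subset-of-size {n} zero p _ = ∅ , ⊥⊆ , ∣⊥∣≡0 n
subset-of-size (suc k) (inside ∷ p) (s≤s k≤∣p∣) with subset-of-size k p k≤∣p∣
... | q , q⊆p , ∣q∣≡k = inside ∷ q , s⊆s q⊆p , cong suc ∣q∣≡k
subset-of-size (suc k) (outside ∷ p) k<∣p∣ with subset-of-size (suc k) p k<∣p∣
... | q , q⊆p , ∣q∣≡k = outside ∷ q , s⊆s q⊆p , ∣q∣≡k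

x∈∁[p∪q]⁻ : ∀ {n} {x : Fin n} (p q : Subset n) → x ∈ ∁ (p ∪ q) → x ∉ p × x ∉ q
x∈∁[p∪q]⁻ p q x∈∁ = (λ x∈p → x∈∁p⇒x∉p x∈∁ (p⊆p∪q q x∈p)) , (λ x∈q → x∈∁p⇒x∉p x∈∁ (q⊆p∪q p q x∈q))

q⊆∁p⇒Empty[p∩q] : ∀ {n} {p q : Subset n} → q ⊆ ∁ p → Empty (p ∩ q)
q⊆∁p⇒Empty[p∩q] {p = p} {q} q⊆∁p (x , x∈p∩q) with x∈p∩q⁻ p q x∈p∩q
... | x∈p , x∈q = x∈∁p⇒x∉p (q⊆∁p x∈q) x∈p

∣p∩q∣+∣p∩r∣≤∣p∣ : ∀ {n} (p q r : Subset n) → Empty (q ∩ r) → ∣ p ∩ q ∣ + ∣ p ∩ r ∣ ≤ ∣ p ∣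
∣p∩q∣+∣p∩r∣≤∣p∣ p q r q∩r=∅ =
  subst (_≤ ∣ p ∣) (∣p∪q∣≡∣p∣+∣q∣ (p ∩ q) (p ∩ r) disjoint′) (p⊆q⇒∣p∣≤∣q∣ ⊆p)
  where
  disjoint′ : Empty ((p ∩ q) ∩ (p ∩ r))
  disjoint′ (x , x∈) with x∈p∩q⁻ (p ∩ q) (p ∩ r) x∈
  ... | x∈p∩q , x∈p∩r = q∩r=∅ (x , x∈p∩q⁺ (proj₂ (x∈p∩q⁻ p q x∈p∩q) , proj₂ (x∈p∩q⁻ p r x∈p∩r)))
  ⊆p : (p ∩ q) ∪ (p ∩ r) ⊆ p
  ⊆p {x} x∈ with x∈p∪q⁻ (p ∩ q) (p ∩ r) x∈
  ... | inj₁ x∈p∩q = p∩q⊆p p q x∈p∩q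
  ... | inj₂ x∈p∩r = p∩q⊆p p r x∈p∩r

∣p∣≤∣∁[q∪r]∣+∣p∩q∣+∣p∩r∣ : ∀ {n} (p q r : Subset n) →
  ∣ p ∣ ≤ ∣ ∁ (q ∪ r) ∣ + (∣ p ∩ q ∣ + ∣ p ∩ r ∣)
∣p∣≤∣∁[q∪r]∣+∣p∩q∣+∣p∩r∣ p q r = begin
  ∣ p ∣                                        ≤⟨ p⊆q⇒∣p∣≤∣q∣ covered ⟩
  ∣ ∁ (q ∪ r) ∪ (p ∩ q) ∪ (p ∩ r) ∣            ≤⟨ ∣p∪q∣≤∣p∣+∣q∣ (∁ (q ∪ r)) _ ⟩
  ∣ ∁ (q ∪ r) ∣ + ∣ (p ∩ q) ∪ (p ∩ r) ∣        ≤⟨ +-monoʳ-≤ ∣ ∁ (q ∪ r) ∣ (∣p∪q∣≤∣p∣+∣q∣ (p ∩ q) (p ∩ r)) ⟩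
  ∣ ∁ (q ∪ r) ∣ + (∣ p ∩ q ∣ + ∣ p ∩ r ∣)      ∎
  where
  open ≤-Reasoning
  covered : p ⊆ ∁ (q ∪ r) ∪ (p ∩ q) ∪ (p ∩ r)
  covered {x} x∈p with x ∈? q ∪ r
  ... | no x∉q∪r = p⊆p∪q _ (x∉p⇒x∈∁p x∉q∪r)
  ... | yes x∈q∪r with x∈p∪q⁻ q r x∈q∪r
  ...   | inj₁ x∈q = q⊆p∪q (∁ (q ∪ r)) _ (p⊆p∪q (p ∩ r) (x∈p∩q⁺ (x∈p , x∈q)))
  ...   | inj₂ x∈r = q⊆p∪q (∁ (q ∪ r)) _ (q⊆p∪q (p ∩ q) (p ∩ r) (x∈p∩q⁺ (x∈p , x∈r)))

module _ {b : ℕ} where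

  open +-*-Solver

  private
    Colour-set : Set
    Colour-set = Subset (2 * b + 1)

  2b+1≡[b+1]+b : 2 * b + 1 ≡ (b + 1) + b
  2b+1≡[b+1]+b = solve 1 (λ b → con 2 :* b :+ con 1 := (b :+ con 1) :+ b) refl b

  2b+1≡b+[b+1] : 2 * b + 1 ≡ b + (b + 1)
  2b+1≡b+[b+1] = solve 1 (λ b → con 2 :* b :+ con 1 := b :+ (b :+ con 1)) refl b

  2b+1≡[b+b]+1 : 2 * b + 1 ≡ (b + b) + 1
  2b+1≡[b+b]+1 = solve 1 (λ b → con 2 :* b :+ con 1 := (b :+ b) :+ con 1) refl b

  ∣∁p∣≡b+1 : (p : Colour-set) → ∣ p ∣ ≡ b → ∣ ∁ p ∣ ≡ b + 1
  ∣∁p∣≡b+1 p ∣p∣≡b = ∣p∣+k≡n⇒∣∁p∣≡k p (trans (cong (_+ (b + 1)) ∣p∣≡b) (sym 2b+1≡b+[b+1]))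

  ∣∁[p∪q]∣≡1 : (p q : Colour-set) → ∣ p ∣ ≡ b → ∣ q ∣ ≡ b → Empty (p ∩ q) → ∣ ∁ (p ∪ q) ∣ ≡ 1
  ∣∁[p∪q]∣≡1 p q ∣p∣≡b ∣q∣≡b p∩q=∅ = ∣p∣+k≡n⇒∣∁p∣≡k (p ∪ q) (begin
    ∣ p ∪ q ∣ + 1      ≡⟨ cong (_+ 1) (∣p∪q∣≡∣p∣+∣q∣ p q p∩q=∅) ⟩
    ∣ p ∣ + ∣ q ∣ + 1  ≡⟨ cong₂ (λ i j → i + j + 1) ∣p∣≡b ∣q∣≡b ⟩
    b + b + 1          ≡⟨ 2b+1≡[b+b]+1 ⟨
    2 * b + 1          ∎)
    where open ≡-Reasoning

  neighbour : Colour-set → Fin (2 * b + 1) → Colour-set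
  neighbour p z = ∁ (p ∪ ⁅ z ⁆)

  ∣neighbour∣≡b : ∀ {p z} → ∣ p ∣ ≡ b → z ∉ p → ∣ neighbour p z ∣ ≡ b
  ∣neighbour∣≡b {p} {z} ∣p∣≡b z∉p = ∣p∣+k≡n⇒∣∁p∣≡k (p ∪ ⁅ z ⁆) (begin
    ∣ p ∪ ⁅ z ⁆ ∣ + b      ≡⟨ cong (_+ b) (∣p∪q∣≡∣p∣+∣q∣ p ⁅ z ⁆ p∩⁅z⁆=∅) ⟩
    ∣ p ∣ + ∣ ⁅ z ⁆ ∣ + b  ≡⟨ cong₂ (λ i j → i + j + b) ∣p∣≡b (∣⁅x⁆∣≡1 z) ⟩
    b + 1 + b              ≡⟨ 2b+1≡[b+1]+b ⟨
    2 * b + 1              ∎)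
    where
    open ≡-Reasoning
    p∩⁅z⁆=∅ : Empty (p ∩ ⁅ z ⁆)
    p∩⁅z⁆=∅ (x , x∈) with x∈p∩q⁻ p ⁅ z ⁆ x∈
    ... | x∈p , x∈⁅z⁆ = z∉p (subst (_∈ p) (x∈⁅y⁆⇒x≡y z x∈⁅z⁆) x∈p)

  neighbour-disjoint : ∀ p z → Empty (p ∩ neighbour p z)
  neighbour-disjoint p z = q⊆∁p⇒Empty[p∩q] (p⊆q⇒∁p⊇∁q (p⊆p∪q ⁅ z ⁆))

  exchange : Colour-set → Fin (2 * b + 1) → Fin (2 * b + 1) → Colour-set
  exchange s y x = neighbour (neighbour s y) x

  ∈-exchange⁻ : ∀ {s y x w} → w ∈ exchange s y x → (w ∈ s ⊎ w ≡ y) × w ≢ x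
  ∈-exchange⁻ {s} {y} {x} {w} w∈ with x∈∁[p∪q]⁻ (neighbour s y) ⁅ x ⁆ w∈
  ... | w∉n , w∉⁅x⁆ = ∈s∪⁅y⁆ (x∉∁p⇒x∈p w∉n) , x∉⁅y⁆⇒x≢y w∉⁅x⁆
    where
    ∈s∪⁅y⁆ : w ∈ s ∪ ⁅ y ⁆ → w ∈ s ⊎ w ≡ y
    ∈s∪⁅y⁆ w∈s∪y with x∈p∪q⁻ s ⁅ y ⁆ w∈s∪y
    ... | inj₁ w∈s = inj₁ w∈s
    ... | inj₂ w∈⁅y⁆ = inj₂ (x∈⁅y⁆⇒x≡y y w∈⁅y⁆)

  first : ∀ {m} → Coloring b m → Colour-set
  first φ = col φ fz

  last : ∀ {m} → Coloring b m → Colour-set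
  last {m} φ = col φ (fromℕ m)

  init : ∀ {m} → Coloring b (suc m) → Coloring b m
  init φ = record
    { col = col φ ∘ inject₁ ; size = size φ ∘ inject₁ ; disjoint = disjoint φ ∘ inject₁ }

  prepend : ∀ {m} (s : Colour-set) → ∣ s ∣ ≡ b → (φ : Coloring b m) → Empty (s ∩ first φ) →
            Coloring b (suc m)
  prepend {m} s ∣s∣≡b φ s∩φ₀=∅ = record { col = col′ ; size = size′ ; disjoint = disjoint′ }
    where
    col′ : Fin (suc (suc m)) → Colour-set
    col′ fz = s
    col′ (fs i) = col φ i
    size′ : ∀ v → ∣ col′ v ∣ ≡ b
    size′ fz = ∣s∣≡b
    size′ (fs i) = size φ i
    disjoint′ : ∀ (i : Fin (suc m)) → Empty (col′ (inject₁ i) ∩ col′ (fs i))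
    disjoint′ fz = s∩φ₀=∅
    disjoint′ (fs i) = disjoint φ i

  endsOverlap : ∀ {m} → Coloring b m → ℕ
  endsOverlap φ = ∣ first φ ∩ last φ ∣

  endsOverlap-subst : ∀ {m m′} (m≡m′ : m ≡ m′) (φ : Coloring b m) →
                      endsOverlap (subst (Coloring b) m≡m′ φ) ≡ endsOverlap φ
  endsOverlap-subst refl φ = refl

  endsOverlap-even : ∀ t (φ : Coloring b (2 * t)) → b ≤ t + endsOverlap φ
  endsOverlap-odd : ∀ t (φ : Coloring b (suc (2 * t))) → endsOverlap φ ≤ t

  endsOverlap-even zero φ =
    ≤-reflexive (trans (sym (size φ fz)) (cong ∣_∣ (sym (∩-idem (first φ)))))
  endsOverlap-even (suc t) φ = begin
    b                                                         ≡⟨ size ψ fz ⟨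
    ∣ first ψ ∣                                               ≤⟨ ∣p∣≤∣∁[q∪r]∣+∣p∩q∣+∣p∩r∣ (first ψ) (last (init ψ)) (last ψ) ⟩
    ∣ ∁ (last (init ψ) ∪ last ψ) ∣ + (endsOverlap (init ψ) + endsOverlap ψ)
      ≡⟨ cong (_+ (endsOverlap (init ψ) + endsOverlap ψ)) (∣∁[p∪q]∣≡1 _ _ (size ψ _) (size ψ _) (disjoint ψ (fromℕ _))) ⟩
    suc (endsOverlap (init ψ) + endsOverlap ψ)                ≤⟨ s≤s (+-monoˡ-≤ _ (endsOverlap-odd t (init ψ))) ⟩
    suc t + endsOverlap ψ                                     ≡⟨ cong (suc t +_) (endsOverlap-subst (*-suc 2 t) φ) ⟩
    suc t + endsOverlap φ                                     ∎
    where
    open ≤-Reasoning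
    ψ : Coloring b (suc (suc (2 * t)))
    ψ = subst (Coloring b) (*-suc 2 t) φ
  endsOverlap-odd t φ = +-cancelˡ-≤ (endsOverlap (init φ)) _ _ (begin
    endsOverlap (init φ) + endsOverlap φ  ≤⟨ ∣p∩q∣+∣p∩r∣≤∣p∣ (first φ) _ _ (disjoint φ (fromℕ _)) ⟩
    ∣ first φ ∣                           ≡⟨ size φ fz ⟩
    b                                     ≤⟨ endsOverlap-even t (init φ) ⟩
    t + endsOverlap (init φ)              ≡⟨ +-comm t _ ⟩
    endsOverlap (init φ) + t              ∎)
    where open ≤-Reasoning

  Walk : ℕ → Colour-set → Colour-set → Set
  Walk m s u = Σ (Coloring b m) λ φ → first φ ≡ s × last φ ≡ u

  walk-stay : ∀ {s} → ∣ s ∣ ≡ b → Walk 0 s s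
  walk-stay {s} ∣s∣≡b = record { col = λ _ → s ; size = λ _ → ∣s∣≡b ; disjoint = λ () } , refl , refl

  walk-cons : ∀ {m s t u} → ∣ s ∣ ≡ b → Empty (s ∩ t) → Walk m t u → Walk (suc m) s u
  walk-cons {s = s} ∣s∣≡b s∩t=∅ (φ , φ₀≡t , φₘ≡u) =
    prepend s ∣s∣≡b φ (subst (λ c → Empty (s ∩ c)) (sym φ₀≡t) s∩t=∅) , refl , φₘ≡u

  exchange∩∁⊆ : ∀ s u {y x} → y ∈ u ⊎ x ≡ y → exchange s y x ∩ ∁ u ⊆ (s ∩ ∁ u) - x
  exchange∩∁⊆ s u {y} {x} y∈u⊎x≡y {w} w∈ with x∈p∩q⁻ (exchange s y x) (∁ u) w∈
  ... | w∈e , w∈∁u with ∈-exchange⁻ w∈e | y∈u⊎x≡y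
  ...   | inj₁ w∈s , w≢x | _ = x∈p∧x≢y⇒x∈p-y (x∈p∩q⁺ (w∈s , w∈∁u)) w≢x
  ...   | inj₂ refl , _  | inj₁ y∈u = contradiction y∈u (x∈∁p⇒x∉p w∈∁u)
  ...   | inj₂ refl , w≢x | inj₂ x≡y = contradiction (sym x≡y) w≢x

  distance-reducing-exchange : ∀ {k} s u → ∣ s ∣ ≡ b → ∣ u ∣ ≡ b → ∣ s ∩ ∁ u ∣ ≤ suc k →
    ∃[ y ] ∃[ x ] (y ∉ s × x ∉ neighbour s y × ∣ exchange s y x ∩ ∁ u ∣ ≤ k)
  distance-reducing-exchange {k} s u ∣s∣≡b ∣u∣≡b d≤1+k with nonempty? (s ∩ ∁ u)
  ... | no s∩∁u=∅ = y , y , x∈∁p⇒x∉p y∈∁s , x∈p⇒x∉∁p (q⊆p∪q s ⁅ y ⁆ (x∈⁅x⁆ y)) , (begin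
    ∣ exchange s y y ∩ ∁ u ∣  ≤⟨ p⊆q⇒∣p∣≤∣q∣ (exchange∩∁⊆ s u {y} {y} (inj₂ refl)) ⟩
    ∣ (s ∩ ∁ u) - y ∣         ≤⟨ ∣p─q∣≤∣p∣ (s ∩ ∁ u) ⁅ y ⁆ ⟩
    ∣ s ∩ ∁ u ∣               ≡⟨ Empty⇒∣p∣≡0 s∩∁u=∅ ⟩
    0                         ≤⟨ z≤n ⟩
    k                         ∎)
    where
    open ≤-Reasoning
    ∃y∈∁s : Nonempty (∁ s)
    ∃y∈∁s = 0<∣p∣⇒Nonempty (∁ s) (subst (0 <_) (sym (∣∁p∣≡b+1 s ∣s∣≡b)) (m≤n+m 1 b))
    y = proj₁ ∃y∈∁s
    y∈∁s = proj₂ ∃y∈∁s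
  ... | yes (x , x∈s∩∁u) = y , x , y∉s , x∈p⇒x∉∁p (p⊆p∪q ⁅ y ⁆ x∈s) , s≤s⁻¹ (begin-strict
    ∣ exchange s y x ∩ ∁ u ∣  ≤⟨ p⊆q⇒∣p∣≤∣q∣ (exchange∩∁⊆ s u {y} {x} (inj₁ y∈u)) ⟩
    ∣ (s ∩ ∁ u) - x ∣         <⟨ x∈p⇒∣p-x∣<∣p∣ x∈s∩∁u ⟩
    ∣ s ∩ ∁ u ∣               ≤⟨ d≤1+k ⟩
    suc k                     ∎)
    where
    open ≤-Reasoning
    x∈s = proj₁ (x∈p∩q⁻ s (∁ u) x∈s∩∁u)
    ∃y∈u∩∁s : Nonempty (u ∩ ∁ s)
    ∃y∈u∩∁s = 0<∣p∣⇒Nonempty (u ∩ ∁ s)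
      (subst (0 <_) (∣p∩∁q∣≡∣q∩∁p∣ s u (trans ∣s∣≡b (sym ∣u∣≡b))) (x∈p⇒0<∣p∣ x∈s∩∁u))
    y = proj₁ ∃y∈u∩∁s
    y∈u = proj₁ (x∈p∩q⁻ u (∁ s) (proj₂ ∃y∈u∩∁s))
    y∉s = x∈∁p⇒x∉p (proj₂ (x∈p∩q⁻ u (∁ s) (proj₂ ∃y∈u∩∁s)))

  walk-of-distance : ∀ k {s u} → ∣ s ∣ ≡ b → ∣ u ∣ ≡ b → ∣ s ∩ ∁ u ∣ ≤ k → Walk (2 * k) s u
  walk-of-distance zero {s} {u} ∣s∣≡b ∣u∣≡b d≤0 =
    subst (Walk 0 s) (p⊆q∧∣p∣≡∣q∣⇒p≡q s⊆u (trans ∣s∣≡b (sym ∣u∣≡b))) (walk-stay ∣s∣≡b)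
    where
    s⊆u : s ⊆ u
    s⊆u {x} x∈s with x ∈? u
    ... | yes x∈u = x∈u
    ... | no x∉u = contradiction d≤0 (<⇒≱ (x∈p⇒0<∣p∣ (x∈p∩q⁺ (x∈s , x∉p⇒x∈∁p x∉u))))
  walk-of-distance (suc k) {s} {u} ∣s∣≡b ∣u∣≡b d≤1+k
    with distance-reducing-exchange s u ∣s∣≡b ∣u∣≡b d≤1+k
  ... | y , x , y∉s , x∉t , d′≤k = subst (λ m → Walk m s u) (sym (*-suc 2 k))
    (walk-cons ∣s∣≡b (neighbour-disjoint s y)
      (walk-cons ∣t∣≡b (neighbour-disjoint (neighbour s y) x)
        (walk-of-distance k (∣neighbour∣≡b ∣t∣≡b x∉t) ∣u∣≡b d′≤k)))
    where
    ∣t∣≡b = ∣neighbour∣≡b ∣s∣≡b y∉s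

  walk-through : ∀ {n} {a c u : Colour-set} → ∣ a ∣ ≡ b → ∣ c ∣ ≡ b → ∣ u ∣ ≡ b →
    Empty (a ∩ c) → ∣ c ∩ ∁ u ∣ ≤ n →
    Σ (Coloring b (suc (2 * n))) λ φ → first φ ≡ a × last φ ≡ u × col φ (fs fz) ≡ c
  walk-through {n} ∣a∣≡b ∣c∣≡b ∣u∣≡b a∩c=∅ d≤n
    with walk-of-distance n ∣c∣≡b ∣u∣≡b d≤n
  ... | ψ , ψ₀≡c , ψₘ≡u = proj₁ (walk-cons ∣a∣≡b a∩c=∅ (ψ , ψ₀≡c , ψₘ≡u)) , refl , ψₘ≡u , ψ₀≡c

  ∣∁[p∪q]∣≡n+1 : ∀ {n} {p q : Colour-set} → n ≤ b → ∣ p ∣ ≡ b → q ⊆ ∁ p → ∣ q ∣ ≡ b ∸ n →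
                 ∣ ∁ (p ∪ q) ∣ ≡ n + 1
  ∣∁[p∪q]∣≡n+1 {n} {p} {q} n≤b ∣p∣≡b q⊆∁p ∣q∣≡b∸n = ∣p∣+k≡n⇒∣∁p∣≡k (p ∪ q) (begin
    ∣ p ∪ q ∣ + (n + 1)      ≡⟨ cong (_+ (n + 1)) (∣p∪q∣≡∣p∣+∣q∣ p q (q⊆∁p⇒Empty[p∩q] q⊆∁p)) ⟩
    ∣ p ∣ + ∣ q ∣ + (n + 1)  ≡⟨ cong₂ (λ i j → i + j + (n + 1)) ∣p∣≡b ∣q∣≡b∸n ⟩
    b + (b ∸ n) + (n + 1)    ≡⟨ +-assoc b (b ∸ n) (n + 1) ⟩
    b + (b ∸ n + (n + 1))    ≡⟨ cong (b +_) (+-assoc (b ∸ n) n 1) ⟨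
    b + (b ∸ n + n + 1)      ≡⟨ cong (λ i → b + (i + 1)) (m∸n+n≡m n≤b) ⟩
    b + (b + 1)              ≡⟨ 2b+1≡b+[b+1] ⟨
    2 * b + 1                ∎)
    where open ≡-Reasoning

  recolouring : ∀ {n} {a u x : Colour-set} → n ≤ b → ∣ a ∣ ≡ b → ∣ u ∣ ≡ b →
    x ⊆ u ∩ ∁ a → ∣ x ∣ ≡ b ∸ n → (y : Colour-set) → y ⊆ ∁ (a ∪ x) → ∣ y ∣ ≡ n →
    Σ (Coloring b (suc (2 * n))) λ φ → first φ ≡ a × last φ ≡ u × col φ (fs fz) ≡ x ∪ y
  recolouring {n} {a} {u} {x} n≤b ∣a∣≡b ∣u∣≡b x⊆u∖a ∣x∣≡b∸n y y⊆∁[a∪x] ∣y∣≡n =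
    walk-through ∣a∣≡b ∣x∪y∣≡b ∣u∣≡b (q⊆∁p⇒Empty[p∩q] x∪y⊆∁a) (subst (_ ≤_) ∣y∣≡n (p⊆q⇒∣p∣≤∣q∣ x∪y∖u⊆y))
    where
    y⊆∁x : y ⊆ ∁ x
    y⊆∁x = p⊆q⇒∁p⊇∁q (q⊆p∪q a x) ∘ y⊆∁[a∪x]
    ∣x∪y∣≡b : ∣ x ∪ y ∣ ≡ b
    ∣x∪y∣≡b = begin
      ∣ x ∪ y ∣      ≡⟨ ∣p∪q∣≡∣p∣+∣q∣ x y (q⊆∁p⇒Empty[p∩q] y⊆∁x) ⟩
      ∣ x ∣ + ∣ y ∣  ≡⟨ cong₂ _+_ ∣x∣≡b∸n ∣y∣≡n ⟩
      b ∸ n + n      ≡⟨ m∸n+n≡m n≤b ⟩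
      b              ∎
      where open ≡-Reasoning
    x∪y⊆∁a : x ∪ y ⊆ ∁ a
    x∪y⊆∁a w∈x∪y with x∈p∪q⁻ x y w∈x∪y
    ... | inj₁ w∈x = proj₂ (x∈p∩q⁻ u (∁ a) (x⊆u∖a w∈x))
    ... | inj₂ w∈y = p⊆q⇒∁p⊇∁q (p⊆p∪q x) (y⊆∁[a∪x] w∈y)
    x∪y∖u⊆y : (x ∪ y) ∩ ∁ u ⊆ y
    x∪y∖u⊆y w∈ with x∈p∩q⁻ (x ∪ y) (∁ u) w∈
    ... | w∈x∪y , w∈∁u with x∈p∪q⁻ x y w∈x∪y
    ...   | inj₁ w∈x = contradiction (proj₁ (x∈p∩q⁻ u (∁ a) (x⊆u∖a w∈x))) (x∈∁p⇒x∉p w∈∁u)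
    ...   | inj₂ w∈y = w∈y

  new-colours-at-odd-distance : ∀ n (φ : Coloring b (suc (2 * n))) →
    b ∸ n ≤ ∣ last φ ∩ ∁ (first φ) ∣
  new-colours-at-odd-distance n φ = m≤n+o⇒m∸n≤o b n (begin
    b                                                ≡⟨ size φ (fromℕ _) ⟨
    ∣ last φ ∣                                       ≡⟨ ∣p∣≡∣p∩q∣+∣p∩∁q∣ (last φ) (first φ) ⟩
    ∣ last φ ∩ first φ ∣ + ∣ last φ ∩ ∁ (first φ) ∣  ≤⟨ +-monoˡ-≤ _ overlap≤n ⟩
    n + ∣ last φ ∩ ∁ (first φ) ∣                     ∎)
    where
    open ≤-Reasoning
    overlap≤n : ∣ last φ ∩ first φ ∣ ≤ n
    overlap≤n = subst (_≤ n) (cong ∣_∣ (∩-comm (first φ) (last φ))) (endsOverlap-odd n φ)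

lemma5 : (b n : ℕ) → 1 ≤ b → n ≤ b ∸ 1 → (φ : Coloring b (suc (2 * n))) →
    ∃[ X ] ∃[ Y ] (X ≢ Y × ∣ X ∣ ≡ b ∸ n × ∣ Y ∣ ≡ n + 1 ×
      ((Y' : Subset (2 * b + 1)) → Y' ⊆ Y → ∣ Y' ∣ ≡ n →
        Σ (Coloring b (suc (2 * n))) λ φ' → (col φ' Fin.zero ≡ col φ Fin.zero ×
                 col φ' (fromℕ (suc (2 * n))) ≡ col φ (fromℕ (suc (2 * n))) ×
                 col φ' (Fin.suc Fin.zero) ≡ X ∪ Y')))
lemma5 b n _ n≤b∸1 φ = X , Y , X≢Y , ∣X∣≡b∸n , ∣Y∣≡n+1 , λ Y' Y'⊆Y ∣Y'∣≡n →
  recolouring n≤b (size φ _) (size φ _) X⊆B∖A ∣X∣≡b∸n Y' Y'⊆Y ∣Y'∣≡n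
  where
  A = first φ
  B = last φ
  n≤b : n ≤ b
  n≤b = ≤-trans n≤b∸1 (m∸n≤m b 1)
  X-spec = subset-of-size (b ∸ n) (B ∩ ∁ A) (new-colours-at-odd-distance n φ)
  X = proj₁ X-spec
  X⊆B∖A = proj₁ (proj₂ X-spec)
  ∣X∣≡b∸n = proj₂ (proj₂ X-spec)
  Y = ∁ (A ∪ X)
  ∣Y∣≡n+1 : ∣ Y ∣ ≡ n + 1
  ∣Y∣≡n+1 = ∣∁[p∪q]∣≡n+1 n≤b (size φ _) (proj₂ ∘ x∈p∩q⁻ B (∁ A) ∘ X⊆B∖A) ∣X∣≡b∸n
  X≢Y : X ≢ Y
  X≢Y X≡Y with 0<∣p∣⇒Nonempty Y (subst (0 <_) (sym ∣Y∣≡n+1) (m≤n+m 1 n))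
  ... | y , y∈Y = proj₂ (x∈∁[p∪q]⁻ A X y∈Y) (subst (y ∈_) (sym X≡Y) y∈Y)
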